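{- Let $X$ be a cubic vertex-transitive graph for which $1$ is a simple eigenvalue, with $V^+$, $V^-$, cycles $C_1,\dots,C_m$, $D_1,\dots,D_m$ and contracted multigraph $G$ as defined below. Then $\mathrm{Aut}(X)\le \mathrm{Aut}(G)$ (every automorphism of $X$ induces an automorphism of $G$), and any subgroup of $\mathrm{Aut}(X)$ acting transitively on $V(X)$ acts transitively on the arcs of $G$. In particular, $G$ is arc-transitive and bipartite.
   Context: Let $\mathbf{z}\in\{1,-1\}^{V(X)}$ be an eigenvector of the adjacency matrix of $X$ for eigenvalue $1$, $V^+=\{x\mid\mathbf{z}(x)=1\}$, $V^-=\{x\mid \mathbf{z}(x)=-1\}$. Then each vertex has two neighbours in its own part and one in the other, and the induced subgraphs $X[V^+]$ and $X[V^-]$ are each a disjoint union of $m$ cycles of a common length $k$; denote these cycles $C_1,\dots,C_m$ (in $X[V^+]$) and $D_1,\dots,D_m$ (in $X[V^-]$). The contracted multigraph $G$ has $2m$ vertices $c_1,\dots,c_m,d_1,\dots,d_m$ (one for each cycle) and, for each edge of $X$ joining a vertex of $C_i$ to a vertex of $D_r$, one edge joining $c_i$ and $d_r$. -}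

module Defs where

open import Data.Nat using (ℕ)
open import Data.Fin using (Fin)
open import Data.Bool using (Bool; true; false; if_then_else_)
open import Data.List using (List; foldr; map; allFin; filter; length)
open import Data.Rational using (ℚ; 0ℚ; 1ℚ; _+_; _*_; -_)
open import Data.Fin.Permutation using (Permutation′; _⟨$⟩ʳ_; _∘ₚ_; flip; id)
open import Data.Product using (Σ; _×_; _,_; ∃; ∃-syntax)
open import Data.Sum using (_⊎_)
open import Relation.Nullary using (¬_)
open import Relation.Binary.PropositionalEquality using (_≡_; _≢_)
open import Relation.Binary.Construct.Closure.ReflexiveTransitive using (Star)

record SimpleGraph (n : ℕ) : Set where
  field
    adj    : Fin n → Fin n → Bool
    sym    : ∀ x y → adj x y ≡ adj y x
    irrefl : ∀ x → adj x x ≡ false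
open SimpleGraph public

module _ {n : ℕ} (X : SimpleGraph n) where

  Adj : Fin n → Fin n → Set
  Adj x y = adj X x y ≡ true

  degree : Fin n → ℕ
  degree x = length (filter (λ y → adj X x y Data.Bool.≟ true) (allFin n))

  Cubic : Set
  Cubic = ∀ x → degree x ≡ 3

  IsAut : Permutation′ n → Set
  IsAut σ = ∀ x y → adj X (σ ⟨$⟩ʳ x) (σ ⟨$⟩ʳ y) ≡ adj X x y

  VertexTransitive : Set
  VertexTransitive = ∀ x y → Σ (Permutation′ n) λ σ → IsAut σ × σ ⟨$⟩ʳ x ≡ y

  sumℚ : List ℚ → ℚ
  sumℚ = foldr _+_ 0ℚ

  A· : (Fin n → ℚ) → Fin n → ℚ
  A· v x = sumℚ (map (λ y → if adj X x y then v y else 0ℚ) (allFin n))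

  EigenEq : ℚ → (Fin n → ℚ) → Set
  EigenEq λ' v = ∀ x → A· v x ≡ λ' * v x

  -- λ' is a simple eigenvalue of A: its eigenspace (over ℚ) is one-dimensional
  SimpleEigenvalue : ℚ → Set
  SimpleEigenvalue λ' =
    Σ (Fin n → ℚ) λ u → EigenEq λ' u × (∃[ x ] u x ≢ 0ℚ)
      × (∀ v → EigenEq λ' v → ∃[ c ] (∀ x → v x ≡ c * u x))

  module _ (z : Fin n → ℚ) where

    -- edges of the induced subgraphs X[V⁺] and X[V⁻]
    InPartEdge : Fin n → Fin n → Set
    InPartEdge x y = Adj x y × z x ≡ z y

    -- x and y lie on the same cycle (same connected component of X[V⁺] or X[V⁻]);
    -- the vertices of G are the classes of this equivalence relation
    SameCycle : Fin n → Fin n → Set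
    SameCycle = Star InPartEdge

    -- arcs of X between V⁺ and V⁻; these are exactly the arcs of the multigraph G
    -- (the arc (x , y) of G goes from the cycle of x to the cycle of y along the
    -- edge of G coming from the edge xy of X)
    CrossArc : Fin n → Fin n → Set
    CrossArc x y = Adj x y × z x ≢ z y

    -- the automorphism σ of X induces an automorphism of G (vertex map
    -- [x] ↦ [σ x] well defined and injective, edges/arcs mapped bijectively with
    -- incidences preserved), and the induced automorphism is trivial only if σ is.
    InducesAutG : Permutation′ n → Set
    InducesAutG σ =
      (∀ x y → SameCycle x y → SameCycle (σ ⟨$⟩ʳ x) (σ ⟨$⟩ʳ y))
      × (∀ x y → SameCycle (σ ⟨$⟩ʳ x) (σ ⟨$⟩ʳ y) → SameCycle x y)
      × (∀ x y → CrossArc x y → CrossArc (σ ⟨$⟩ʳ x) (σ ⟨$⟩ʳ y))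
      × (∀ x y → CrossArc (σ ⟨$⟩ʳ x) (σ ⟨$⟩ʳ y) → CrossArc x y)
      × ((∀ x → SameCycle (σ ⟨$⟩ʳ x) x)
         → (∀ x y → CrossArc x y →
              (σ ⟨$⟩ʳ x ≡ x × σ ⟨$⟩ʳ y ≡ y) ⊎ (σ ⟨$⟩ʳ x ≡ y × σ ⟨$⟩ʳ y ≡ x))
         → ∀ x → σ ⟨$⟩ʳ x ≡ x)

    IsAutSubgroup : (Permutation′ n → Set) → Set
    IsAutSubgroup H =
      (∀ σ → H σ → IsAut σ) × H id
      × (∀ σ τ → H σ → H τ → H (σ ∘ₚ τ)) × (∀ σ → H σ → H (flip σ))

    TransitiveOnV : (Permutation′ n → Set) → Set
    TransitiveOnV H = ∀ x y → Σ (Permutation′ n) λ σ → H σ × σ ⟨$⟩ʳ x ≡ y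

    TransitiveOnArcsG : (Permutation′ n → Set) → Set
    TransitiveOnArcsG H =
      ∀ x y x' y' → CrossArc x y → CrossArc x' y' →
        Σ (Permutation′ n) λ σ → H σ × σ ⟨$⟩ʳ x ≡ x' × σ ⟨$⟩ʳ y ≡ y'

    -- G is arc-transitive: any arc can be mapped to any other by an automorphism
    -- of G (here: one induced by an automorphism of X)
    ArcTransitiveG : Set
    ArcTransitiveG =
      ∀ x y x' y' → CrossArc x y → CrossArc x' y' →
        Σ (Permutation′ n) λ σ → IsAut σ × InducesAutG σ
          × σ ⟨$⟩ʳ x ≡ x' × σ ⟨$⟩ʳ y ≡ y'

    -- G is bipartite with parts {c_i} (cycles in V⁺) and {d_r} (cycles in V⁻)
    BipartiteG : Set
    BipartiteG =
      (∀ x y → SameCycle x y → z x ≡ z y)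
      × (∀ x y → CrossArc x y → (z x ≡ 1ℚ × z y ≡ - 1ℚ) ⊎ (z x ≡ - 1ℚ × z y ≡ 1ℚ))

module Submission where

-- At every vertex the neighbour sum of the ±1 eigenvector z for the eigenvalue 1
-- is z x, and three signs summing to z x contain exactly one entry differing from
-- it: every vertex has a unique neighbour in the other part, i.e. the edges of G
-- form a perfect matching of X.  An automorphism σ turns z into the eigenvector
-- z ∘ σ for 1, so by simplicity z ∘ σ = c z; hence σ preserves the partition
-- {V⁺, V⁻} (possibly swapping the parts) and with it the in-part edges, the
-- cycles and the cross edges.  As cross neighbours are unique, an automorphism
-- taking x to x' takes the cross arc at x to the cross arc at x', so every group
-- transitive on V(X) is transitive on the arcs of G.

open import Defs hiding (sym)
open import Data.Nat using (ℕ; zero; suc)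
open import Data.Fin using (Fin; zero; suc)
open import Data.Rational using (ℚ; 1ℚ; -_; 0ℚ; _+_; _*_; 1/_; ≢-nonZero)
open import Data.Rational.Properties
  using (*-identityˡ; *-inverseˡ; *-assoc; *-zeroˡ; +-identityˡ; +-0-commutativeMonoid)
open import Data.Fin.Permutation
  using (Permutation′; _⟨$⟩ʳ_; _⟨$⟩ˡ_; inverseˡ; inverseʳ; flip)
open import Data.Product using (_×_; _,_; proj₂; ∃)
open import Data.Sum using (_⊎_; inj₁; inj₂)
open import Data.Bool using (true; false; if_then_else_)
import Data.Bool as Bool
open import Data.List using (List; []; _∷_; foldr; map; allFin; filter; length; tabulate)
open import Data.List.Properties using (map-tabulate)
open import Data.List.Membership.Propositional using (_∈_)
open import Data.List.Membership.Propositional.Properties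
  using (∈-allFin; ∈-filter⁺; ∈-filter⁻)
open import Data.List.Relation.Unary.Any using (here; there)
open import Data.Empty using (⊥-elim)
open import Relation.Binary.PropositionalEquality
  using (_≡_; _≢_; refl; sym; trans; cong; cong₂; subst₂; module ≡-Reasoning)
open import Relation.Binary.Construct.Closure.ReflexiveTransitive using (ε; _◅_; gmap)
open import Function using (_∘_)
import Algebra.Properties.CommutativeMonoid.Sum as Sum

open Sum +-0-commutativeMonoid using (sum; sum-cong-≗; sum-permute)

IsSign : ℚ → Set
IsSign q = q ≡ 1ℚ ⊎ q ≡ - 1ℚ

sign≢0 : ∀ {q} → IsSign q → q ≢ 0ℚ
sign≢0 (inj₁ refl) ()
sign≢0 (inj₂ refl) ()

*-cancelˡ-≡ : ∀ c {a b} → c ≢ 0ℚ → c * a ≡ c * b → a ≡ b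
*-cancelˡ-≡ c {a} {b} c≢0 ca≡cb = begin
    a                ≡⟨ sym (*-identityˡ a) ⟩
    1ℚ * a           ≡⟨ cong (_* a) (sym (*-inverseˡ c)) ⟩
    (1/ c * c) * a   ≡⟨ *-assoc (1/ c) c a ⟩
    1/ c * (c * a)   ≡⟨ cong (1/ c *_) ca≡cb ⟩
    1/ c * (c * b)   ≡⟨ *-assoc (1/ c) c b ⟨
    (1/ c * c) * b   ≡⟨ cong (_* b) (*-inverseˡ c) ⟩
    1ℚ * b           ≡⟨ *-identityˡ b ⟩
    b                ∎
  where
    open ≡-Reasoning
    instance
      c≢0′ = ≢-nonZero c≢0

ExactlyOneDiffers : ℚ → ℚ → ℚ → ℚ → Set
ExactlyOneDiffers a b c w =
  (a ≢ w × b ≡ w × c ≡ w) ⊎ (a ≡ w × b ≢ w × c ≡ w) ⊎ (a ≡ w × b ≡ w × c ≢ w)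

sign-sum-three : ∀ {a b c w} → IsSign a → IsSign b → IsSign c → IsSign w →
                 a + (b + (c + 0ℚ)) ≡ w → ExactlyOneDiffers a b c w
sign-sum-three (inj₁ refl) (inj₁ refl) (inj₁ refl) (inj₁ refl) ()
sign-sum-three (inj₁ refl) (inj₁ refl) (inj₁ refl) (inj₂ refl) ()
sign-sum-three (inj₁ refl) (inj₁ refl) (inj₂ refl) (inj₁ refl) _ = inj₂ (inj₂ (refl , refl , λ ()))
sign-sum-three (inj₁ refl) (inj₁ refl) (inj₂ refl) (inj₂ refl) ()
sign-sum-three (inj₁ refl) (inj₂ refl) (inj₁ refl) (inj₁ refl) _ = inj₂ (inj₁ (refl , (λ ()) , refl))
sign-sum-three (inj₁ refl) (inj₂ refl) (inj₁ refl) (inj₂ refl) ()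
sign-sum-three (inj₁ refl) (inj₂ refl) (inj₂ refl) (inj₁ refl) ()
sign-sum-three (inj₁ refl) (inj₂ refl) (inj₂ refl) (inj₂ refl) _ = inj₁ ((λ ()) , refl , refl)
sign-sum-three (inj₂ refl) (inj₁ refl) (inj₁ refl) (inj₁ refl) _ = inj₁ ((λ ()) , refl , refl)
sign-sum-three (inj₂ refl) (inj₁ refl) (inj₁ refl) (inj₂ refl) ()
sign-sum-three (inj₂ refl) (inj₁ refl) (inj₂ refl) (inj₁ refl) ()
sign-sum-three (inj₂ refl) (inj₁ refl) (inj₂ refl) (inj₂ refl) _ = inj₂ (inj₁ (refl , (λ ()) , refl))
sign-sum-three (inj₂ refl) (inj₂ refl) (inj₁ refl) (inj₁ refl) ()
sign-sum-three (inj₂ refl) (inj₂ refl) (inj₁ refl) (inj₂ refl) _ = inj₂ (inj₂ (refl , refl , λ ()))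
sign-sum-three (inj₂ refl) (inj₂ refl) (inj₂ refl) (inj₁ refl) ()
sign-sum-three (inj₂ refl) (inj₂ refl) (inj₂ refl) (inj₂ refl) ()

record OddOneOut {A : Set} (f : A → ℚ) (w : ℚ) (L : List A) : Set where
  field
    odd        : A
    odd∈       : odd ∈ L
    odd≢       : f odd ≢ w
    odd-unique : ∀ y → y ∈ L → f y ≢ w → y ≡ odd

oddOneOut-three : ∀ {A : Set} (f : A → ℚ) {w} a b c →
                  ExactlyOneDiffers (f a) (f b) (f c) w → OddOneOut f w (a ∷ b ∷ c ∷ [])
oddOneOut-three f a b c (inj₁ (a≢ , b≡ , c≡)) = record
  { odd = a ; odd∈ = here refl ; odd≢ = a≢
  ; odd-unique = λ { _ (here refl) _ → refl
                   ; _ (there (here refl)) b≢ → ⊥-elim (b≢ b≡)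
                   ; _ (there (there (here refl))) c≢ → ⊥-elim (c≢ c≡) } }
oddOneOut-three f a b c (inj₂ (inj₁ (a≡ , b≢ , c≡))) = record
  { odd = b ; odd∈ = there (here refl) ; odd≢ = b≢
  ; odd-unique = λ { _ (here refl) a≢ → ⊥-elim (a≢ a≡)
                   ; _ (there (here refl)) _ → refl
                   ; _ (there (there (here refl))) c≢ → ⊥-elim (c≢ c≡) } }
oddOneOut-three f a b c (inj₂ (inj₂ (a≡ , b≡ , c≢))) = record
  { odd = c ; odd∈ = there (there (here refl)) ; odd≢ = c≢
  ; odd-unique = λ { _ (here refl) a≢ → ⊥-elim (a≢ a≡)
                   ; _ (there (here refl)) b≢ → ⊥-elim (b≢ b≡)
                   ; _ (there (there (here refl))) _ → refl } }

signs-sum-three⇒oddOneOut : ∀ {A : Set} (f : A → ℚ) {w} (L : List A) →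
  length L ≡ 3 → (∀ y → IsSign (f y)) → IsSign w →
  foldr _+_ 0ℚ (map f L) ≡ w → OddOneOut f w L
signs-sum-three⇒oddOneOut f (a ∷ b ∷ c ∷ []) refl sign w-sign sum≡w =
  oddOneOut-three f a b c (sign-sum-three (sign a) (sign b) (sign c) w-sign sum≡w)

sum-tabulate : ∀ {m} (g : Fin m → ℚ) → foldr _+_ 0ℚ (tabulate g) ≡ sum g
sum-tabulate {zero}  g = refl
sum-tabulate {suc m} g = cong (g zero +_) (sum-tabulate (g ∘ suc))

module _ {n : ℕ} (X : SimpleGraph n) where

  neighbours : Fin n → List (Fin n)
  neighbours x = filter (λ y → adj X x y Bool.≟ true) (allFin n)

  ∈-neighbours⁺ : ∀ {x y} → Adj X x y → y ∈ neighbours x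
  ∈-neighbours⁺ {x} {y} = ∈-filter⁺ (λ y → adj X x y Bool.≟ true) (∈-allFin y)

  ∈-neighbours⁻ : ∀ {x y} → y ∈ neighbours x → Adj X x y
  ∈-neighbours⁻ {x} y∈ =
    proj₂ (∈-filter⁻ (λ y → adj X x y Bool.≟ true) {xs = allFin n} y∈)

  A·-neighbours : ∀ v x → A· X v x ≡ foldr _+_ 0ℚ (map v (neighbours x))
  A·-neighbours v x = go (allFin n)
    where
      go : ∀ ys → foldr _+_ 0ℚ (map (λ y → if adj X x y then v y else 0ℚ) ys)
                ≡ foldr _+_ 0ℚ (map v (filter (λ y → adj X x y Bool.≟ true) ys))
      go []       = refl
      go (y ∷ ys) with adj X x y
      ... | true  = cong (v y +_) (go ys)
      ... | false = trans (+-identityˡ _) (go ys)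

  A·-sum : ∀ v x → A· X v x ≡ sum (λ y → if adj X x y then v y else 0ℚ)
  A·-sum v x = trans (cong (foldr _+_ 0ℚ) (map-tabulate (λ y → y) row)) (sum-tabulate row)
    where
      row : Fin n → ℚ
      row y = if adj X x y then v y else 0ℚ

  A·-∘-aut : ∀ σ → IsAut X σ → ∀ v x → A· X (v ∘ (σ ⟨$⟩ʳ_)) x ≡ A· X v (σ ⟨$⟩ʳ x)
  A·-∘-aut σ aut v x = begin
      A· X (v ∘ (σ ⟨$⟩ʳ_)) x
        ≡⟨ A·-sum (v ∘ (σ ⟨$⟩ʳ_)) x ⟩
      sum (λ y → if adj X x y then v (σ ⟨$⟩ʳ y) else 0ℚ)
        ≡⟨ sum-cong-≗ (λ y →
             cong (λ b → if b then v (σ ⟨$⟩ʳ y) else 0ℚ) (sym (aut x y))) ⟩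
      sum (λ y → if adj X (σ ⟨$⟩ʳ x) (σ ⟨$⟩ʳ y) then v (σ ⟨$⟩ʳ y) else 0ℚ)
        ≡⟨ sum-permute (λ y → if adj X (σ ⟨$⟩ʳ x) y then v y else 0ℚ) σ ⟨
      sum (λ y → if adj X (σ ⟨$⟩ʳ x) y then v y else 0ℚ)
        ≡⟨ A·-sum v (σ ⟨$⟩ʳ x) ⟨
      A· X v (σ ⟨$⟩ʳ x)
        ∎
    where open ≡-Reasoning

  eigenEq-∘-aut : ∀ σ → IsAut X σ →
    ∀ λ' v → EigenEq X λ' v → EigenEq X λ' (v ∘ (σ ⟨$⟩ʳ_))
  eigenEq-∘-aut σ aut λ' v eig x = trans (A·-∘-aut σ aut v x) (eig (σ ⟨$⟩ʳ x))

  isAut-flip : ∀ σ → IsAut X σ → IsAut X (flip σ)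
  isAut-flip σ aut x y =
    trans (sym (aut (σ ⟨$⟩ˡ x) (σ ⟨$⟩ˡ y))) (cong₂ (adj X) (inverseʳ σ) (inverseʳ σ))

  aut-reflects : ∀ {R : Fin n → Fin n → Set} →
    (∀ τ → IsAut X τ → ∀ x y → R x y → R (τ ⟨$⟩ʳ x) (τ ⟨$⟩ʳ y)) →
    ∀ σ → IsAut X σ → ∀ x y → R (σ ⟨$⟩ʳ x) (σ ⟨$⟩ʳ y) → R x y
  aut-reflects {R} preserves σ aut x y =
    subst₂ R (inverseˡ σ) (inverseˡ σ)
      ∘ preserves (flip σ) (isAut-flip σ aut) (σ ⟨$⟩ʳ x) (σ ⟨$⟩ʳ y)

  -- The eigenspace is spanned by u, so v = c u and w = d u with c ≢ 0.
  eigen-level-sets : ∀ λ' → SimpleEigenvalue X λ' →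
    ∀ v w → EigenEq X λ' v → EigenEq X λ' w →
    (∀ x → v x ≢ 0ℚ) → ∀ x y → v x ≡ v y → w x ≡ w y
  eigen-level-sets λ' (u , _ , _ , spans) v w eig-v eig-w v≢0 x y vx≡vy
    with spans v eig-v | spans w eig-w
  ... | c , v≡cu | d , w≡du = begin
      w x       ≡⟨ w≡du x ⟩
      d * u x   ≡⟨ cong (d *_) (*-cancelˡ-≡ c c≢0 cux≡cuy) ⟩
      d * u y   ≡⟨ w≡du y ⟨
      w y       ∎
    where
      open ≡-Reasoning
      c≢0 : c ≢ 0ℚ
      c≢0 c≡0 = v≢0 x (trans (v≡cu x) (trans (cong (_* u x) c≡0) (*-zeroˡ (u x))))
      cux≡cuy : c * u x ≡ c * u y
      cux≡cuy = trans (sym (v≡cu x)) (trans vx≡vy (v≡cu y))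

module SignEigenvector {n : ℕ} (X : SimpleGraph n) (cubic : Cubic X) (z : Fin n → ℚ)
                       (sign : ∀ x → IsSign (z x)) (eig : EigenEq X 1ℚ z) where

  sameCycle⇒≡ : ∀ {x y} → SameCycle X z x y → z x ≡ z y
  sameCycle⇒≡ ε               = refl
  sameCycle⇒≡ ((_ , e) ◅ xy) = trans e (sameCycle⇒≡ xy)

  crossArc-signs : ∀ x y → CrossArc X z x y →
    (z x ≡ 1ℚ × z y ≡ - 1ℚ) ⊎ (z x ≡ - 1ℚ × z y ≡ 1ℚ)
  crossArc-signs x y (_ , zx≢zy) with sign x | sign y
  ... | inj₁ p | inj₁ q = ⊥-elim (zx≢zy (trans p (sym q)))
  ... | inj₁ p | inj₂ q = inj₁ (p , q)
  ... | inj₂ p | inj₁ q = inj₂ (p , q)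
  ... | inj₂ p | inj₂ q = ⊥-elim (zx≢zy (trans p (sym q)))

  crossNeighbour : ∀ x → OddOneOut z (z x) (neighbours X x)
  crossNeighbour x = signs-sum-three⇒oddOneOut z (neighbours X x) (cubic x) sign (sign x)
    (trans (sym (A·-neighbours X z x)) (trans (eig x) (*-identityˡ (z x))))

  crossArc-exists : ∀ x → ∃ (CrossArc X z x)
  crossArc-exists x = odd , ∈-neighbours⁻ X odd∈ , odd≢ ∘ sym
    where open OddOneOut (crossNeighbour x)

  crossArc-unique : ∀ {x y y'} → CrossArc X z x y → CrossArc X z x y' → y ≡ y'
  crossArc-unique {x} {y} {y'} (xy , zx≢zy) (xy' , zx≢zy') =
    trans (odd-unique y (∈-neighbours⁺ X xy) (zx≢zy ∘ sym))
          (sym (odd-unique y' (∈-neighbours⁺ X xy') (zx≢zy' ∘ sym)))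
    where open OddOneOut (crossNeighbour x)

  crossArc-image : ∀ σ →
    (∀ x y → CrossArc X z x y → CrossArc X z (σ ⟨$⟩ʳ x) (σ ⟨$⟩ʳ y)) →
    ∀ {x y x' y'} → σ ⟨$⟩ʳ x ≡ x' →
    CrossArc X z x y → CrossArc X z x' y' → σ ⟨$⟩ʳ y ≡ y'
  crossArc-image σ preserves refl xy = crossArc-unique (preserves _ _ xy)

  -- The cross neighbour of x lies on another cycle, so σ cannot swap x with it.
  fixing-cycles-and-cross-edges⇒id : ∀ σ →
    (∀ x → SameCycle X z (σ ⟨$⟩ʳ x) x) →
    (∀ x y → CrossArc X z x y →
       (σ ⟨$⟩ʳ x ≡ x × σ ⟨$⟩ʳ y ≡ y) ⊎ (σ ⟨$⟩ʳ x ≡ y × σ ⟨$⟩ʳ y ≡ x)) →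
    ∀ x → σ ⟨$⟩ʳ x ≡ x
  fixing-cycles-and-cross-edges⇒id σ fixes-cycles fixes-edges x
    with crossArc-exists x
  ... | y , xy with fixes-edges x y xy
  ... | inj₁ (σx≡x , _) = σx≡x
  ... | inj₂ (σx≡y , _) =
    ⊥-elim (proj₂ xy (trans (sym (sameCycle⇒≡ (fixes-cycles x))) (cong z σx≡y)))

  module _ (simple : SimpleEigenvalue X 1ℚ) where

    aut-preserves-level-sets : ∀ σ → IsAut X σ →
      ∀ x y → z x ≡ z y → z (σ ⟨$⟩ʳ x) ≡ z (σ ⟨$⟩ʳ y)
    aut-preserves-level-sets σ aut =
      eigen-level-sets X 1ℚ simple z (z ∘ (σ ⟨$⟩ʳ_))
        eig (eigenEq-∘-aut X σ aut 1ℚ z eig) (λ x → sign≢0 (sign x))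

    aut-preserves-sameCycle : ∀ σ → IsAut X σ → ∀ x y →
      SameCycle X z x y → SameCycle X z (σ ⟨$⟩ʳ x) (σ ⟨$⟩ʳ y)
    aut-preserves-sameCycle σ aut _ _ =
      gmap (σ ⟨$⟩ʳ_) λ {a} {b} (ab , za≡zb) →
        trans (aut a b) ab , aut-preserves-level-sets σ aut a b za≡zb

    aut-preserves-crossArc : ∀ σ → IsAut X σ → ∀ x y →
      CrossArc X z x y → CrossArc X z (σ ⟨$⟩ʳ x) (σ ⟨$⟩ʳ y)
    aut-preserves-crossArc σ aut x y (xy , zx≢zy) =
      trans (aut x y) xy , zx≢zy ∘ aut-reflects X aut-preserves-level-sets σ aut x y

    aut-inducesAutG : ∀ σ → IsAut X σ → InducesAutG X z σ
    aut-inducesAutG σ aut =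
      aut-preserves-sameCycle σ aut ,
      aut-reflects X aut-preserves-sameCycle σ aut ,
      aut-preserves-crossArc σ aut ,
      aut-reflects X aut-preserves-crossArc σ aut ,
      fixing-cycles-and-cross-edges⇒id σ

lemma4p2 : (n : ℕ) (X : SimpleGraph n) → Cubic X → VertexTransitive X
    → SimpleEigenvalue X 1ℚ
    → (z : Fin n → ℚ) → (∀ x → z x ≡ 1ℚ ⊎ z x ≡ - 1ℚ) → EigenEq X 1ℚ z
    → (∀ σ → IsAut X σ → InducesAutG X z σ)
    × (∀ (H : Permutation′ n → Set) → IsAutSubgroup X z H → TransitiveOnV X z H
    → TransitiveOnArcsG X z H)
    × ArcTransitiveG X z × BipartiteG X z
lemma4p2 n X cubic vertex-transitive simple z sign eig =
  aut-inducesAutG simple , subgroup-arc-transitive , arc-transitive ,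
  (λ _ _ → sameCycle⇒≡) , crossArc-signs
  where
    open SignEigenvector X cubic z sign eig

    subgroup-arc-transitive : ∀ H → IsAutSubgroup X z H → TransitiveOnV X z H →
                              TransitiveOnArcsG X z H
    subgroup-arc-transitive H (H⊆Aut , _) transitive x y x' y' xy x'y'
      with transitive x x'
    ... | σ , σ∈H , σx≡x' = σ , σ∈H , σx≡x' ,
      crossArc-image σ (aut-preserves-crossArc simple σ (H⊆Aut σ σ∈H)) σx≡x' xy x'y'

    arc-transitive : ArcTransitiveG X z
    arc-transitive x y x' y' xy x'y' with vertex-transitive x x'
    ... | σ , aut , σx≡x' = σ , aut , aut-inducesAutG simple σ aut , σx≡x' ,
      crossArc-image σ (aut-preserves-crossArc simple σ aut) σx≡x' xy x'y'
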